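{- For every closed $\mathrm{BCCSP}_{\|}$ term $p$ there exists a closed BCCSP term $q$ (one with no occurrence of $\|$) such that $\mathcal{E}_{\mathtt{S}}\vdash p\approx q$, where $\mathcal{E}_{\mathtt{S}}=\mathcal{E}_1\cup\{\mathrm{S},\mathrm{SP1},\mathrm{SP2},\mathrm{EL1}\}$.
   Context: Let $\mathcal{A}$ be a finite non-empty set of actions and $\mathcal{V}$ a countably infinite set of variables. $\mathrm{BCCSP}_{\|}$ terms: $t ::= \mathbf{0} \mid x \mid a.t \mid t+t \mid t \,\|\, t$ ($a\in\mathcal{A}$, $x \in \mathcal{V}$; $ax$ means $a.x$); BCCSP terms are those without $\|$; closed terms contain no variables. $\mathcal{E}\vdash t\approx u$: derivable in equational logic (reflexivity, symmetry, transitivity, substitution instances of axioms, closure under $a.\_$, $+$, $\|$). Axioms with concrete action names stand for all instances with actions from $\mathcal{A}$. $\mathcal{E}_1$: A0 $x+\mathbf{0}\approx x$; A1 $x+y\approx y+x$; A2 $(x+y)+z \approx x+(y+z)$; A3 $x+x\approx x$; P0 $x\|\mathbf{0}\approx x$; P1 $x\|y \approx y \| x$. S: $a(x+y)\approx a(x+y)+ax$. SP1: $(x+y)\|(z+w)\approx x\|(z+w)+y\|(z+w)+(x+y)\|z+(x+y)\|w$. SP2: $ax\|(y+z)\approx a(x\|(y+z))+ax\|y+ax\|z$. EL1: $ax\|by\approx a(x\|by)+b(ax\|y)$. -}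

module Defs where

open import Data.Nat using (ℕ; suc)
open import Data.Fin using (Fin)
open import Data.Empty using (⊥)
open import Data.Unit using (⊤)
open import Data.Product using (_×_)

-- The action set 𝒜 is a finite non-empty set: we take 𝒜 = Fin (suc n)
-- for an arbitrary n.  The variable set 𝒱 is ℕ (countably infinite).
module BCCSP (n : ℕ) where

  Act : Set
  Act = Fin (suc n)

  Var : Set
  Var = ℕ

  infixr 7 _∙_
  infixl 5 _⊕_
  infixl 6 _∥_

  data Term : Set where
    𝟎   : Term
    var : Var → Term
    _∙_ : Act → Term → Term
    _⊕_ : Term → Term → Term
    _∥_ : Term → Term → Term

  Closed : Term → Set
  Closed 𝟎 = ⊤
  Closed (var _) = ⊥
  Closed (a ∙ t) = Closed t
  Closed (t ⊕ u) = Closed t × Closed u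
  Closed (t ∥ u) = Closed t × Closed u

  ParFree : Term → Set
  ParFree 𝟎 = ⊤
  ParFree (var _) = ⊤
  ParFree (a ∙ t) = ParFree t
  ParFree (t ⊕ u) = ParFree t × ParFree u
  ParFree (t ∥ u) = ⊥

  sub : (Var → Term) → Term → Term
  sub σ 𝟎 = 𝟎
  sub σ (var x) = σ x
  sub σ (a ∙ t) = a ∙ sub σ t
  sub σ (t ⊕ u) = sub σ t ⊕ sub σ u
  sub σ (t ∥ u) = sub σ t ∥ sub σ u

  x y z w : Term
  x = var 0
  y = var 1
  z = var 2
  w = var 3

  data AxS : Term → Term → Set where
    A0  : AxS (x ⊕ 𝟎) x
    A1  : AxS (x ⊕ y) (y ⊕ x)
    A2  : AxS ((x ⊕ y) ⊕ z) (x ⊕ (y ⊕ z))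
    A3  : AxS (x ⊕ x) x
    P0  : AxS (x ∥ 𝟎) x
    P1  : AxS (x ∥ y) (y ∥ x)
    S   : (a : Act) → AxS (a ∙ (x ⊕ y)) (a ∙ (x ⊕ y) ⊕ a ∙ x)
    SP1 : AxS ((x ⊕ y) ∥ (z ⊕ w))
              ((((x ∥ (z ⊕ w)) ⊕ (y ∥ (z ⊕ w))) ⊕ ((x ⊕ y) ∥ z)) ⊕ ((x ⊕ y) ∥ w))
    SP2 : (a : Act) →
          AxS ((a ∙ x) ∥ (y ⊕ z))
              ((a ∙ (x ∥ (y ⊕ z)) ⊕ ((a ∙ x) ∥ y)) ⊕ ((a ∙ x) ∥ z))
    EL1 : (a b : Act) →
          AxS ((a ∙ x) ∥ (b ∙ y))
              (a ∙ (x ∥ (b ∙ y)) ⊕ b ∙ ((a ∙ x) ∥ y))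

  infix 3 _⊢_≈_
  data _⊢_≈_ (Ax : Term → Term → Set) : Term → Term → Set where
    refl  : ∀ {t} → Ax ⊢ t ≈ t
    sym   : ∀ {t u} → Ax ⊢ t ≈ u → Ax ⊢ u ≈ t
    trans : ∀ {t u v} → Ax ⊢ t ≈ u → Ax ⊢ u ≈ v → Ax ⊢ t ≈ v
    inst  : ∀ {t u} (σ : Var → Term) → Ax t u → Ax ⊢ sub σ t ≈ sub σ u
    pre   : ∀ {t u} (a : Act) → Ax ⊢ t ≈ u → Ax ⊢ a ∙ t ≈ a ∙ u
    plus  : ∀ {t t′ u u′} → Ax ⊢ t ≈ t′ → Ax ⊢ u ≈ u′ → Ax ⊢ t ⊕ u ≈ t′ ⊕ u′
    par   : ∀ {t t′ u u′} → Ax ⊢ t ≈ t′ → Ax ⊢ u ≈ u′ → Ax ⊢ t ∥ u ≈ t′ ∥ u′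

{-# OPTIONS --safe #-}
-- Closed terms are normalised bottom-up; the only work is eliminating p ∥ q for
-- closed BCCSP terms p and q. By lexicographic induction on (p , q), P0/P1 remove 𝟎,
-- SP1 and SP2 (and its mirror image under P1) split a summand on either side, and EL1
-- expands the product of two prefixes into prefixes of strictly smaller products.
module Submission where

open import Defs
open import Data.Nat using (ℕ)
open import Data.Product using (Σ; _×_; _,_)
open import Data.Unit using (tt)

module ParElimination (n : ℕ) where
  open BCCSP n

  IsClosedBCCSP : Term → Set
  IsClosedBCCSP t = Closed t × ParFree t

  ParFreeForm : Term → Set
  ParFreeForm t = Σ Term (λ q → IsClosedBCCSP q × (AxS ⊢ t ≈ q))

  [_,_,_,_] : Term → Term → Term → Term → Var → Term
  [ t , u , v , s ] 0 = t
  [ t , u , v , s ] 1 = u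
  [ t , u , v , s ] 2 = v
  [ t , u , v , s ] _ = s

  ∥-comm : ∀ t u → AxS ⊢ t ∥ u ≈ u ∥ t
  ∥-comm t u = inst [ t , u , 𝟎 , 𝟎 ] P1

  ∥-identityʳ : ∀ t → AxS ⊢ t ∥ 𝟎 ≈ t
  ∥-identityʳ t = inst [ t , 𝟎 , 𝟎 , 𝟎 ] P0

  ∥-identityˡ : ∀ t → AxS ⊢ 𝟎 ∥ t ≈ t
  ∥-identityˡ t = trans (∥-comm 𝟎 t) (∥-identityʳ t)

  ⊕-∥-⊕ : ∀ t₁ t₂ u₁ u₂ →
          AxS ⊢ (t₁ ⊕ t₂) ∥ (u₁ ⊕ u₂) ≈
                t₁ ∥ (u₁ ⊕ u₂) ⊕ t₂ ∥ (u₁ ⊕ u₂) ⊕ (t₁ ⊕ t₂) ∥ u₁ ⊕ (t₁ ⊕ t₂) ∥ u₂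
  ⊕-∥-⊕ t₁ t₂ u₁ u₂ = inst [ t₁ , t₂ , u₁ , u₂ ] SP1

  ∙-∥-⊕ : ∀ a t u₁ u₂ →
          AxS ⊢ a ∙ t ∥ (u₁ ⊕ u₂) ≈ a ∙ (t ∥ (u₁ ⊕ u₂)) ⊕ a ∙ t ∥ u₁ ⊕ a ∙ t ∥ u₂
  ∙-∥-⊕ a t u₁ u₂ = inst [ t , u₁ , u₂ , 𝟎 ] (SP2 a)

  ⊕-∥-∙ : ∀ t₁ t₂ b u →
          AxS ⊢ (t₁ ⊕ t₂) ∥ b ∙ u ≈ b ∙ ((t₁ ⊕ t₂) ∥ u) ⊕ t₁ ∥ b ∙ u ⊕ t₂ ∥ b ∙ u
  ⊕-∥-∙ t₁ t₂ b u =
    trans (∥-comm (t₁ ⊕ t₂) (b ∙ u))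
      (trans (∙-∥-⊕ b u t₁ t₂)
        (plus (plus (pre b (∥-comm u (t₁ ⊕ t₂))) (∥-comm (b ∙ u) t₁))
              (∥-comm (b ∙ u) t₂)))

  ∙-∥-∙ : ∀ a t b u → AxS ⊢ a ∙ t ∥ b ∙ u ≈ a ∙ (t ∥ b ∙ u) ⊕ b ∙ (a ∙ t ∥ u)
  ∙-∥-∙ a t b u = inst [ t , u , 𝟎 , 𝟎 ] (EL1 a b)

  via : ∀ {t u} → AxS ⊢ t ≈ u → ParFreeForm u → ParFreeForm t
  via t≈u (q , isq , u≈q) = q , isq , trans t≈u u≈q

  itself : ∀ {t} → IsClosedBCCSP t → ParFreeForm t
  itself {t} ist = t , ist , refl

  infixr 7 _∙ᶠ_
  infixl 5 _⊕ᶠ_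

  _∙ᶠ_ : ∀ {t} a → ParFreeForm t → ParFreeForm (a ∙ t)
  a ∙ᶠ (q , isq , t≈q) = a ∙ q , isq , pre a t≈q

  _⊕ᶠ_ : ∀ {t u} → ParFreeForm t → ParFreeForm u → ParFreeForm (t ⊕ u)
  (q , (cq , fq) , t≈q) ⊕ᶠ (r , (cr , fr) , u≈r) =
    q ⊕ r , ((cq , cr) , (fq , fr)) , plus t≈q u≈r

  parFreeForm-∥ : ∀ p q → IsClosedBCCSP p → IsClosedBCCSP q → ParFreeForm (p ∥ q)
  parFreeForm-∥ 𝟎 q _ isq = via (∥-identityˡ q) (itself isq)
  parFreeForm-∥ p 𝟎 isp _ = via (∥-identityʳ p) (itself isp)
  parFreeForm-∥ (p₁ ⊕ p₂) (q₁ ⊕ q₂)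
                isp@((cp₁ , cp₂) , (fp₁ , fp₂)) isq@((cq₁ , cq₂) , (fq₁ , fq₂)) =
    via (⊕-∥-⊕ p₁ p₂ q₁ q₂)
      (  parFreeForm-∥ p₁ (q₁ ⊕ q₂) (cp₁ , fp₁) isq
      ⊕ᶠ parFreeForm-∥ p₂ (q₁ ⊕ q₂) (cp₂ , fp₂) isq
      ⊕ᶠ parFreeForm-∥ (p₁ ⊕ p₂) q₁ isp (cq₁ , fq₁)
      ⊕ᶠ parFreeForm-∥ (p₁ ⊕ p₂) q₂ isp (cq₂ , fq₂))
  parFreeForm-∥ (a ∙ p) (q₁ ⊕ q₂) isp isq@((cq₁ , cq₂) , (fq₁ , fq₂)) =
    via (∙-∥-⊕ a p q₁ q₂)
      (  a ∙ᶠ parFreeForm-∥ p (q₁ ⊕ q₂) isp isq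
      ⊕ᶠ parFreeForm-∥ (a ∙ p) q₁ isp (cq₁ , fq₁)
      ⊕ᶠ parFreeForm-∥ (a ∙ p) q₂ isp (cq₂ , fq₂))
  parFreeForm-∥ (p₁ ⊕ p₂) (b ∙ q) isp@((cp₁ , cp₂) , (fp₁ , fp₂)) isq =
    via (⊕-∥-∙ p₁ p₂ b q)
      (  b ∙ᶠ parFreeForm-∥ (p₁ ⊕ p₂) q isp isq
      ⊕ᶠ parFreeForm-∥ p₁ (b ∙ q) (cp₁ , fp₁) isq
      ⊕ᶠ parFreeForm-∥ p₂ (b ∙ q) (cp₂ , fp₂) isq)
  parFreeForm-∥ (a ∙ p) (b ∙ q) isp isq =
    via (∙-∥-∙ a p b q)
      (a ∙ᶠ parFreeForm-∥ p (b ∙ q) isp isq ⊕ᶠ b ∙ᶠ parFreeForm-∥ (a ∙ p) q isp isq)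

  parFreeForm : ∀ p → Closed p → ParFreeForm p
  parFreeForm 𝟎 _ = itself (tt , tt)
  parFreeForm (a ∙ p) cp = a ∙ᶠ parFreeForm p cp
  parFreeForm (p ⊕ q) (cp , cq) = parFreeForm p cp ⊕ᶠ parFreeForm q cq
  parFreeForm (p ∥ q) (cp , cq) with parFreeForm p cp | parFreeForm q cq
  ... | p′ , isp′ , p≈p′ | q′ , isq′ , q≈q′ =
    via (par p≈p′ q≈q′) (parFreeForm-∥ p′ q′ isp′ isq′)

proposition4p4 : (n : ℕ) → let open BCCSP n in
    (p : Term) → Closed p →
    Σ Term (λ q → (Closed q × ParFree q) × (AxS ⊢ p ≈ q))
proposition4p4 = ParElimination.parFreeForm
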